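{- Let $n\ge 4$. For every integer $k$ with $0\le k\le\binom{n+1}{3}$ there exists a permutation $\pi$ of rank $n$ with $\operatorname{ninvsum}(\pi)=k$.
   Context: A permutation of rank $n$ is a bijection $\pi$ of $\{1,\dots,n\}$. A non-inversion of $\pi$ is a pair $(a,b)$ with $1\le a<b\le n$ and $\pi(a)<\pi(b)$, and $\operatorname{ninvsum}(\pi)=\sum(b-a)$, the sum taken over all non-inversions $(a,b)$ of $\pi$. -}

module Defs where

open import Data.Nat using (ℕ; _+_; _∸_; _<_; _<?_)
open import Data.Fin using (Fin; toℕ)
open import Data.Fin.Permutation using (Permutation′; _⟨$⟩ʳ_)
open import Data.List using (List; map; allFin)
open import Data.Nat.ListAction using (sum)
open import Relation.Nullary.Decidable using (Dec; yes; no)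

pairContrib : ∀ {n} → Permutation′ n → Fin n → Fin n → ℕ
pairContrib π a b with toℕ a <? toℕ b | toℕ (π ⟨$⟩ʳ a) <? toℕ (π ⟨$⟩ʳ b)
... | yes _ | yes _ = toℕ b ∸ toℕ a
... | _     | _     = 0

-- ninvsum π = Σ over non-inversions (a,b) of (b - a).
-- (Positions are 0-indexed via Fin n; differences b - a are unaffected.)
ninvsum : ∀ {n} → Permutation′ n → ℕ
ninvsum {n} π = sum (map (λ a → sum (map (λ b → pairContrib π a b) (allFin n))) (allFin n))

-- Prepending a new first entry to a permutation π of rank n shifts every old
-- pair by one position, so old non-inversions keep their weight b - a.  If the
-- new entry is the smallest value it forms a non-inversion with every later
-- position, adding 1 + 2 + … + n = C(n+1,2); if it is the largest it adds
-- nothing.  By Pascal, C(n+2,3) = C(n+1,3) + C(n+1,2), and C(n+1,2) ≤ C(n+1,3) + 1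
-- once n ≥ 4, so the two shifted copies [0, C(n+1,3)] and
-- [C(n+1,2), C(n+1,2) + C(n+1,3)] of the range for rank n cover the range for
-- rank n + 1.  Rank 4 is checked by exhibiting eleven permutations.
module Submission where

open import Defs
open import Data.Nat using (ℕ; zero; suc; _+_; _∸_; _≤_; _<_; _<?_; _≤?_; z≤n; s≤s; s≤s⁻¹)
open import Data.Nat.Properties
open import Data.Nat.Combinatorics using (_C_; nCk+nC[k+1]≡[n+1]C[k+1]; nC1≡n)
open import Data.Fin using (Fin; toℕ; fromℕ; inject₁; punchIn; #_) renaming (zero to 0F; suc to 1+_)
open import Data.Fin.Properties using (toℕ<n; toℕ-fromℕ; toℕ-inject₁)
open import Data.Fin.Permutation using (Permutation′; _⟨$⟩ʳ_; lift₀; insert; id)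
open import Data.List using (map; allFin; tabulate)
open import Data.List.Properties using (map-tabulate)
import Data.Nat.ListAction as List
open import Algebra.Properties.Monoid.Sum +-0-monoid
  using (sum; sum-syntax; sum-cong-≗; sum-replicate-zero; sum-init-last)
open import Data.Product using (Σ; _,_)
open import Relation.Nullary using (¬_; Dec; yes; no; contradiction)
open import Function using (_∘_)
open import Relation.Binary.PropositionalEquality

contribution : (a b πa πb : ℕ) → ℕ
contribution a b πa πb with a <? b | πa <? πb
... | yes _ | yes _ = b ∸ a
... | _     | _     = 0

pairContrib≡contribution : ∀ {n} (π : Permutation′ n) a b →
  pairContrib π a b ≡ contribution (toℕ a) (toℕ b) (toℕ (π ⟨$⟩ʳ a)) (toℕ (π ⟨$⟩ʳ b))
pairContrib≡contribution π a b with toℕ a <? toℕ b | toℕ (π ⟨$⟩ʳ a) <? toℕ (π ⟨$⟩ʳ b)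
... | yes _ | yes _ = refl
... | yes _ | no  _ = refl
... | no  _ | _     = refl

contribution-nonInversion : ∀ {a b πa πb} → a < b → πa < πb →
  contribution a b πa πb ≡ b ∸ a
contribution-nonInversion {a} {b} {πa} {πb} a<b πa<πb with a <? b | πa <? πb
... | yes _   | yes _    = refl
... | no  a≮b | _        = contradiction a<b a≮b
... | yes _   | no πa≮πb = contradiction πa<πb πa≮πb

contribution-unorderedPositions : ∀ {a b πa πb} → ¬ a < b → contribution a b πa πb ≡ 0
contribution-unorderedPositions {a} {b} {πa} {πb} a≮b with a <? b | πa <? πb
... | yes a<b | yes _ = contradiction a<b a≮b
... | yes _   | no  _ = refl
... | no  _   | _     = refl

contribution-inversion : ∀ {a b πa πb} → ¬ πa < πb → contribution a b πa πb ≡ 0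
contribution-inversion {a} {b} {πa} {πb} πa≮πb with a <? b | πa <? πb
... | yes _ | yes πa<πb = contradiction πa<πb πa≮πb
... | yes _ | no  _     = refl
... | no  _ | _         = refl

contribution-shift : ∀ c a b πa πb →
  contribution (suc a) (suc b) (c + πa) (c + πb) ≡ contribution a b πa πb
contribution-shift c a b πa πb = byCases (a <? b) (πa <? πb)
  where
  byCases : Dec (a < b) → Dec (πa < πb) →
    contribution (suc a) (suc b) (c + πa) (c + πb) ≡ contribution a b πa πb
  byCases (yes a<b) (yes πa<πb) =
    trans (contribution-nonInversion (s≤s a<b) (+-monoʳ-< c πa<πb))
          (sym (contribution-nonInversion a<b πa<πb))
  byCases (yes _)   (no πa≮πb) =
    trans (contribution-inversion {suc a} {suc b} (πa≮πb ∘ +-cancelˡ-< c πa πb))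
          (sym (contribution-inversion {a} {b} πa≮πb))
  byCases (no a≮b)  _ =
    trans (contribution-unorderedPositions {πa = c + πa} {c + πb} (a≮b ∘ s≤s⁻¹))
          (sym (contribution-unorderedPositions {πa = πa} {πb} a≮b))

sum-map-allFin : ∀ {n} (f : Fin n → ℕ) → List.sum (map f (allFin n)) ≡ sum f
sum-map-allFin {n} f = trans (cong List.sum (map-tabulate (λ i → i) f)) (sum-tabulate f)
  where
  sum-tabulate : ∀ {m} (g : Fin m → ℕ) → List.sum (tabulate g) ≡ sum g
  sum-tabulate {zero}  g = refl
  sum-tabulate {suc m} g = cong (g 0F +_) (sum-tabulate (λ i → g (1+ i)))

ninvsum≡∑∑ : ∀ {n} (π : Permutation′ n) →
  ninvsum π ≡ ∑[ a < n ] ∑[ b < n ] pairContrib π a b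
ninvsum≡∑∑ {n} π =
  trans (sum-map-allFin (λ a → List.sum (map (pairContrib π a) (allFin n))))
        (sum-cong-≗ (λ a → sum-map-allFin (pairContrib π a)))

ninvsum-prepend : ∀ {n} (π′ : Permutation′ (suc n)) (π : Permutation′ n) c →
  (∀ a → toℕ (π′ ⟨$⟩ʳ 1+ a) ≡ c + toℕ (π ⟨$⟩ʳ a)) →
  ninvsum π′ ≡ ∑[ b < n ] pairContrib π′ 0F (1+ b) + ninvsum π
ninvsum-prepend {n} π′ π c π′∘1+≡c+π = begin
  ninvsum π′
    ≡⟨ ninvsum≡∑∑ π′ ⟩
  ∑[ a < suc n ] ∑[ b < suc n ] pairContrib π′ a b
    ≡⟨ cong₂ _+_ (cong (_+ firstRow) (firstColumn 0F)) (sum-cong-≗ otherRow) ⟩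
  firstRow + ∑[ a < n ] ∑[ b < n ] pairContrib π a b
    ≡⟨ cong (firstRow +_) (ninvsum≡∑∑ π) ⟨
  firstRow + ninvsum π ∎
  where
  open ≡-Reasoning
  firstRow : ℕ
  firstRow = ∑[ b < n ] pairContrib π′ 0F (1+ b)

  firstColumn : ∀ a → pairContrib π′ a 0F ≡ 0
  firstColumn a = refl

  shiftedPair : ∀ a b → pairContrib π′ (1+ a) (1+ b) ≡ pairContrib π a b
  shiftedPair a b = begin
    pairContrib π′ (1+ a) (1+ b)
      ≡⟨ pairContrib≡contribution π′ (1+ a) (1+ b) ⟩
    contribution (suc (toℕ a)) (suc (toℕ b)) (toℕ (π′ ⟨$⟩ʳ 1+ a)) (toℕ (π′ ⟨$⟩ʳ 1+ b))
      ≡⟨ cong₂ (contribution (suc (toℕ a)) (suc (toℕ b))) (π′∘1+≡c+π a) (π′∘1+≡c+π b) ⟩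
    contribution (suc (toℕ a)) (suc (toℕ b)) (c + toℕ (π ⟨$⟩ʳ a)) (c + toℕ (π ⟨$⟩ʳ b))
      ≡⟨ contribution-shift c (toℕ a) (toℕ b) (toℕ (π ⟨$⟩ʳ a)) (toℕ (π ⟨$⟩ʳ b)) ⟩
    contribution (toℕ a) (toℕ b) (toℕ (π ⟨$⟩ʳ a)) (toℕ (π ⟨$⟩ʳ b))
      ≡⟨ pairContrib≡contribution π a b ⟨
    pairContrib π a b ∎

  otherRow : ∀ a → ∑[ b < suc n ] pairContrib π′ (1+ a) b ≡ ∑[ b < n ] pairContrib π a b
  otherRow a = cong₂ _+_ (firstColumn (1+ a)) (sum-cong-≗ (shiftedPair a))

∑[b<n]1+b≡[n+1]C2 : ∀ n → ∑[ b < n ] suc (toℕ b) ≡ suc n C 2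
∑[b<n]1+b≡[n+1]C2 zero    = refl
∑[b<n]1+b≡[n+1]C2 (suc n) = begin
  ∑[ b < suc n ] suc (toℕ b)
    ≡⟨ sum-init-last (λ b → suc (toℕ b)) ⟩
  ∑[ b < n ] suc (toℕ (inject₁ b)) + suc (toℕ (fromℕ n))
    ≡⟨ cong₂ _+_ (sum-cong-≗ {n} (λ b → cong suc (toℕ-inject₁ b))) (cong suc (toℕ-fromℕ n)) ⟩
  ∑[ b < n ] suc (toℕ b) + suc n
    ≡⟨ cong₂ _+_ (∑[b<n]1+b≡[n+1]C2 n) (sym (nC1≡n (suc n))) ⟩
  suc n C 2 + suc n C 1
    ≡⟨ +-comm (suc n C 2) (suc n C 1) ⟩
  suc n C 1 + suc n C 2
    ≡⟨ nCk+nC[k+1]≡[n+1]C[k+1] (suc n) 1 ⟩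
  suc (suc n) C 2 ∎
  where open ≡-Reasoning

ninvsum-lift₀ : ∀ {n} (π : Permutation′ n) → ninvsum (lift₀ π) ≡ suc n C 2 + ninvsum π
ninvsum-lift₀ {n} π = begin
  ninvsum (lift₀ π)
    ≡⟨ ninvsum-prepend (lift₀ π) π 1 (λ _ → refl) ⟩
  ∑[ b < n ] pairContrib (lift₀ π) 0F (1+ b) + ninvsum π
    ≡⟨ cong (_+ ninvsum π) (sum-cong-≗ firstRowPair) ⟩
  ∑[ b < n ] suc (toℕ b) + ninvsum π
    ≡⟨ cong (_+ ninvsum π) (∑[b<n]1+b≡[n+1]C2 n) ⟩
  suc n C 2 + ninvsum π ∎
  where
  open ≡-Reasoning
  firstRowPair : ∀ b → pairContrib (lift₀ π) 0F (1+ b) ≡ suc (toℕ b)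
  firstRowPair b = refl

toℕ-punchIn-fromℕ : ∀ {n} (i : Fin n) → toℕ (punchIn (fromℕ n) i) ≡ toℕ i
toℕ-punchIn-fromℕ 0F     = refl
toℕ-punchIn-fromℕ (1+ i) = cong suc (toℕ-punchIn-fromℕ i)

ninvsum-insertMax : ∀ {n} (π : Permutation′ n) → ninvsum (insert 0F (fromℕ n) π) ≡ ninvsum π
ninvsum-insertMax {n} π = begin
  ninvsum π′
    ≡⟨ ninvsum-prepend π′ π 0 (λ a → toℕ-punchIn-fromℕ (π ⟨$⟩ʳ a)) ⟩
  ∑[ b < n ] pairContrib π′ 0F (1+ b) + ninvsum π
    ≡⟨ cong (_+ ninvsum π) (trans (sum-cong-≗ firstRowPair) (sum-replicate-zero n)) ⟩
  ninvsum π ∎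
  where
  open ≡-Reasoning
  π′ : Permutation′ (suc n)
  π′ = insert 0F (fromℕ n) π

  firstRowPair : ∀ b → pairContrib π′ 0F (1+ b) ≡ 0
  firstRowPair b = trans (pairContrib≡contribution π′ 0F (1+ b)) (contribution-inversion {0} {suc (toℕ b)} n≮πb)
    where
    n≮πb : ¬ toℕ (fromℕ n) < toℕ (π′ ⟨$⟩ʳ 1+ b)
    n≮πb rewrite toℕ-fromℕ n | toℕ-punchIn-fromℕ (π ⟨$⟩ʳ b) = <-asym (toℕ<n (π ⟨$⟩ʳ b))

n≤nC2 : ∀ n → 3 ≤ n → n ≤ n C 2
n≤nC2 1 (s≤s ())
n≤nC2 2 (s≤s (s≤s ()))
n≤nC2 3 _ = ≤-refl
n≤nC2 (suc n@(suc (suc (suc _)))) _ = begin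
  suc n          ≤⟨ +-monoˡ-≤ n {1} {n} (s≤s z≤n) ⟩
  n + n          ≤⟨ +-monoʳ-≤ n (n≤nC2 n (s≤s (s≤s (s≤s z≤n)))) ⟩
  n + n C 2      ≡⟨ cong (_+ n C 2) (nC1≡n n) ⟨
  n C 1 + n C 2  ≡⟨ nCk+nC[k+1]≡[n+1]C[k+1] n 1 ⟩
  suc n C 2      ∎
  where open ≤-Reasoning

nC2≤1+nC3 : ∀ n → 5 ≤ n → n C 2 ≤ suc (n C 3)
nC2≤1+nC3 1 (s≤s ())
nC2≤1+nC3 2 (s≤s (s≤s ()))
nC2≤1+nC3 3 (s≤s (s≤s (s≤s ())))
nC2≤1+nC3 4 (s≤s (s≤s (s≤s (s≤s ()))))
nC2≤1+nC3 5 _ = n≤1+n 10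
nC2≤1+nC3 (suc n@(suc (suc (suc (suc (suc _)))))) _ = begin
  suc n C 2                ≡⟨ nCk+nC[k+1]≡[n+1]C[k+1] n 1 ⟨
  n C 1 + n C 2            ≡⟨ cong (_+ n C 2) (nC1≡n n) ⟩
  n + n C 2                ≤⟨ +-mono-≤ (n≤nC2 n (s≤s (s≤s (s≤s z≤n)))) (nC2≤1+nC3 n 5≤n) ⟩
  n C 2 + suc (n C 3)      ≡⟨ +-suc (n C 2) (n C 3) ⟩
  suc (n C 2 + n C 3)      ≡⟨ cong suc (nCk+nC[k+1]≡[n+1]C[k+1] n 2) ⟩
  suc (suc n C 3)          ∎
  where
  open ≤-Reasoning
  5≤n : 5 ≤ n
  5≤n = s≤s (s≤s (s≤s (s≤s (s≤s z≤n))))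

NinvsumAttains : ℕ → ℕ → Set
NinvsumAttains n N = ∀ k → k ≤ N → Σ (Permutation′ n) (λ π → ninvsum π ≡ k)

-- lehmer₄ a b c sends 0 to a, 1 to the b-th smallest value other than a (counting
-- from 0), and 2 to the c-th smallest value not yet used.
lehmer₄ : Fin 4 → Fin 3 → Fin 2 → Permutation′ 4
lehmer₄ a b c = insert 0F a (insert 0F b (insert 0F c id))

ninvsum-attains-rank4 : NinvsumAttains 4 10
ninvsum-attains-rank4 0  _ = lehmer₄ (# 3) (# 2) (# 1) , refl
ninvsum-attains-rank4 1  _ = lehmer₄ (# 2) (# 2) (# 1) , refl
ninvsum-attains-rank4 2  _ = lehmer₄ (# 2) (# 2) (# 0) , refl
ninvsum-attains-rank4 3  _ = lehmer₄ (# 1) (# 2) (# 1) , refl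
ninvsum-attains-rank4 4  _ = lehmer₄ (# 1) (# 1) (# 1) , refl
ninvsum-attains-rank4 5  _ = lehmer₄ (# 1) (# 2) (# 0) , refl
ninvsum-attains-rank4 6  _ = lehmer₄ (# 0) (# 2) (# 1) , refl
ninvsum-attains-rank4 7  _ = lehmer₄ (# 0) (# 1) (# 1) , refl
ninvsum-attains-rank4 8  _ = lehmer₄ (# 1) (# 0) (# 1) , refl
ninvsum-attains-rank4 9  _ = lehmer₄ (# 0) (# 0) (# 1) , refl
ninvsum-attains-rank4 10 _ = lehmer₄ (# 0) (# 0) (# 0) , refl
ninvsum-attains-rank4 (suc (suc (suc (suc (suc (suc (suc (suc (suc (suc (suc _)))))))))))
  (s≤s (s≤s (s≤s (s≤s (s≤s (s≤s (s≤s (s≤s (s≤s (s≤s ()))))))))))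

ninvsum-attains-insertMax : ∀ {n N} → NinvsumAttains n N → NinvsumAttains (suc n) N
ninvsum-attains-insertMax {n} attains k k≤N with attains k k≤N
... | π , ninvsumπ≡k = insert 0F (fromℕ n) π , trans (ninvsum-insertMax π) ninvsumπ≡k

ninvsum-attains-lift₀ : ∀ {n N} → NinvsumAttains n N →
  ∀ k → suc n C 2 ≤ k → k ≤ suc n C 2 + N → Σ (Permutation′ (suc n)) (λ π → ninvsum π ≡ k)
ninvsum-attains-lift₀ {n} attains k C2≤k k≤ with attains (k ∸ suc n C 2) (m≤n+o⇒m∸n≤o k (suc n C 2) k≤)
... | π , ninvsumπ≡k∸C2 = lift₀ π , (begin
  ninvsum (lift₀ π)            ≡⟨ ninvsum-lift₀ π ⟩
  suc n C 2 + ninvsum π        ≡⟨ cong (suc n C 2 +_) ninvsumπ≡k∸C2 ⟩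
  suc n C 2 + (k ∸ suc n C 2)  ≡⟨ m+[n∸m]≡n C2≤k ⟩
  k                            ∎)
  where open ≡-Reasoning

ninvsum-attains-step : ∀ {n} → 4 ≤ n → NinvsumAttains n (suc n C 3) →
  NinvsumAttains (suc n) (suc (suc n) C 3)
ninvsum-attains-step {n} 4≤n attains k k≤ with k ≤? suc n C 3
... | yes k≤C3 = ninvsum-attains-insertMax attains k k≤C3
... | no  k≰C3 = ninvsum-attains-lift₀ attains k
      (≤-trans (nC2≤1+nC3 (suc n) (s≤s 4≤n)) (≰⇒> k≰C3))
      (subst (k ≤_) (sym (nCk+nC[k+1]≡[n+1]C[k+1] (suc n) 2)) k≤)

lemma2p9 : (n : ℕ) → 4 ≤ n → (k : ℕ) → k ≤ (suc n) C 3 →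
    Σ (Permutation′ n) (λ π → ninvsum π ≡ k)
lemma2p9 .(4 + m) (s≤s (s≤s (s≤s (s≤s {n = m} z≤n)))) = attains m
  where
  attains : ∀ m → NinvsumAttains (4 + m) (suc (4 + m) C 3)
  attains zero    = ninvsum-attains-rank4
  attains (suc m) = ninvsum-attains-step (s≤s (s≤s (s≤s (s≤s z≤n)))) (attains m)
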